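{- For all integers $n\geq 0$ and $0\leq k\leq n$, the optimal score $\alpha(n,k)$ of the game $F(n,k)$ satisfies $\alpha(n,k)\geq\left\lfloor \frac{n-3k+2}{5}\right\rfloor$.
   Context: The game $F(n,k)$ is played by two players, Maker and Breaker, on the board $\{1,\dots,n\}$. At the start, Breaker claims $k$ elements of her choice; then the players alternately claim previously unclaimed elements, with Maker moving first, until all elements are claimed. The score is the number of pairs $\{i,i+1\}$ ($1\le i\le n-1$) such that both $i$ and $i+1$ are claimed by Maker. Maker aims to maximise the score and Breaker to minimise it; $\alpha(n,k)$ denotes the score when both play optimally. -}

module Defs where

open import Data.Nat using (ℕ; zero; suc; _+_; _⊔_; _⊓_)
open import Data.List using (List; []; _∷_; map; _++_; foldr)
open import Data.Vec using (Vec; []; _∷_)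

-- State of one element of the board {1,…,n}.
-- A board is a Vec Cell n; index i (0-based) represents element i+1.
data Cell : Set where
  free maker breaker : Cell

data Player : Set where
  Maker Breaker : Player

other : Player → Player
other Maker   = Breaker
other Breaker = Maker

owner : Player → Cell
owner Maker   = maker
owner Breaker = breaker

score : ∀ {n} → Vec Cell n → ℕ
score []                      = 0
score (_ ∷ [])                = 0
score (maker ∷ maker ∷ xs)    = suc (score (maker ∷ xs))
score (maker ∷ free ∷ xs)     = score (free ∷ xs)
score (maker ∷ breaker ∷ xs)  = score (breaker ∷ xs)
score (free ∷ y ∷ xs)         = score (y ∷ xs)
score (breaker ∷ y ∷ xs)      = score (y ∷ xs)

moves : ∀ {n} → Player → Vec Cell n → List (Vec Cell n)
moves p []         = []
moves p (free ∷ xs) = (owner p ∷ xs) ∷ map (free ∷_) (moves p xs)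
moves p (c ∷ xs)    = map (c ∷_) (moves p xs)

maxL : ℕ → List ℕ → ℕ
maxL x xs = foldr _⊔_ x xs

minL : ℕ → List ℕ → ℕ
minL x xs = foldr _⊓_ x xs

opt : Player → ℕ → List ℕ → ℕ
opt Maker   = maxL
opt Breaker = minL

-- The fuel argument
-- is an upper bound on the number of free cells (we always use fuel = n,
-- which suffices since a board of size n has at most n free cells).
value : ∀ {n} → ℕ → Player → Vec Cell n → ℕ
value zero    p b = score b
value (suc f) p b with moves p b
... | []     = score b
... | c ∷ cs = opt p (value f (other p) c) (map (value f (other p)) cs)

initial : (n k : ℕ) → List (Vec Cell n)
initial zero    zero    = [] ∷ []
initial zero    (suc k) = []
initial (suc n) zero    = map (free ∷_) (initial n zero)
initial (suc n) (suc k) = map (breaker ∷_) (initial n k) ++ map (free ∷_) (initial n (suc k))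

-- α(n,k): Breaker chooses her k initial elements to minimise the value of
-- the subsequent game, in which Maker moves first.
-- (For k > n there is no initial choice; we set α = 0, but this case is
-- never used since the theorem assumes k ≤ n.)
α : ℕ → ℕ → ℕ
α n k with initial n k
... | []     = 0
... | b ∷ bs = minL (value n Maker b) (map (value n Maker) bs)

module Submission where

-- Proof by a potential function.  Read a board as its maximal runs of free cells, each
-- recording whether its left and right neighbours are Maker cells.  A run is hot when it is
-- nonempty and touches a Maker cell; a position is good when it has at most two hot runs
-- and none touches Maker on both sides.  With player p to move the potential is
--     Φ_p = 5·score + Σ_runs (length ∸ 2) + bonus_p (classes of the hot runs),
-- the bonus tables rewarding Maker for the pairs he can still cash in.  The invariant
-- "Φ_p ≤ 5·value + 3 in every good position" is proved by induction on the free cells: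
-- every Breaker claim keeps the position good and Φ from increasing (Breaker's Φ bounds
-- Maker's Φ afterwards), and Maker always has a claim doing the same in reverse: take a
-- free cell next to one of his own (a new pair), else split a run of ≥ 3 free cells after
-- its first or second cell, else the position is settled and Φ ≤ 5·score + 3.  Initially
-- no run is hot and the k Breaker cells cut the n − k free cells into runs of total
-- excess ≥ n − 3k − 2, which gives 5·α(n,k) + 4 ≥ n − 3k + 2.

open import Defs
open import Data.Nat using (ℕ; zero; suc; _+_; _*_; _∸_; _≤_; _/_; _≤?_; _⊓_; z≤n; s≤s)
open import Data.Nat.Properties
open import Data.Nat.DivMod using (m<n*o⇒m/o<n)
open import Data.Nat.Solver using (module +-*-Solver)
open import Data.Bool using (Bool; true; false)
open import Data.List using (List; []; _∷_; _++_; length; map; concatMap)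
open import Data.Nat.ListAction using (sum)
open import Data.Nat.ListAction.Properties using (sum-++)
open import Data.List.Properties using (∷-injective; ++-assoc; ++-identityʳ; length-++; map-++; concatMap-++; ++-conicalˡ; ++-conicalʳ; foldr-preservesᵇ)
open import Data.List.Membership.Propositional using (_∈_)
open import Data.List.Membership.Propositional.Properties using (∈-map⁺; ∈-map⁻; ∈-++⁺ˡ; ∈-++⁻)
open import Data.List.Relation.Unary.Any.Properties using (¬Any[])
open import Data.List.Relation.Unary.Any using (here; there)
open import Data.List.Relation.Unary.All using (All; []; _∷_; tabulate)
open import Data.List.Relation.Unary.All.Properties using (map⁺)
open import Data.Vec using (Vec; toList) renaming ([] to []ᵥ; _∷_ to _∷ᵥ_)
open import Data.Vec.Properties using (length-toList)
open import Data.Product using (∃; ∃₂; _×_; _,_; proj₁; proj₂)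
open import Data.Sum using (_⊎_; inj₁; inj₂)
import Data.Sum as Sum
open import Data.Empty using (⊥; ⊥-elim)
open import Data.Unit using (⊤; tt)
open import Relation.Nullary.Decidable using (True; toWitness)
open import Relation.Binary.PropositionalEquality
open +-*-Solver using (solve; _:+_; _:*_; _:=_; con)

byEval : ∀ {m n} {ok : True (m ≤? n)} → m ≤ n
byEval {ok = ok} = toWitness ok

-- Every run-length inequality below is of this kind: from length 2 on the excess of
-- a run grows by one per cell, and from length 3 on its bonus class no longer changes.
fromThree : (P : ℕ → Set) → P 0 → P 1 → P 2 → P 3 → (∀ n → P (3 + n) → P (4 + n)) → ∀ n → P n
fromThree P p₀ p₁ p₂ p₃ step zero = p₀
fromThree P p₀ p₁ p₂ p₃ step (suc zero) = p₁
fromThree P p₀ p₁ p₂ p₃ step (suc (suc zero)) = p₂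
fromThree P p₀ p₁ p₂ p₃ step (suc (suc (suc zero))) = p₃
fromThree P p₀ p₁ p₂ p₃ step (suc (suc (suc (suc n)))) =
  step n (fromThree P p₀ p₁ p₂ p₃ step (suc (suc (suc n))))

shifting : ∀ {f g : ℕ → ℕ} {ok₀ : True (f 0 ≤? g 0)} {ok₁ : True (f 1 ≤? g 1)}
           {ok₂ : True (f 2 ≤? g 2)} {ok₃ : True (f 3 ≤? g 3)} →
           (∀ n → f (3 + n) ≤ g (3 + n) → f (4 + n) ≤ g (4 + n)) → ∀ n → f n ≤ g n
shifting {f} {g} {ok₀} {ok₁} {ok₂} {ok₃} step =
  fromThree (λ n → f n ≤ g n) (toWitness ok₀) (toWitness ok₁) (toWitness ok₂) (toWitness ok₃) step

excess : ℕ → ℕ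
excess n = n ∸ 2

excess-split : ∀ l r → excess (suc (l + r)) ≤ excess l + excess r + 3
excess-split l r = begin
  suc (l + r) ∸ 2                             ≤⟨ ∸-monoˡ-≤ 2 (s≤s (+-mono-≤ (m≤n+m∸n l 2) (m≤n+m∸n r 2))) ⟩
  suc ((2 + excess l) + (2 + excess r)) ∸ 2   ≡⟨ cong (_∸ 2) (regroup (excess l) (excess r)) ⟩
  excess l + excess r + 3                     ∎
  where
    open ≤-Reasoning
    regroup : ∀ x y → suc ((2 + x) + (2 + y)) ≡ 2 + (x + y + 3)
    regroup = solve 2 (λ x y → con 1 :+ ((con 2 :+ x) :+ (con 2 :+ y)) := con 2 :+ (x :+ y :+ con 3)) refl

div5-bound : ∀ m v → m ≤ 5 * v + 4 → m / 5 ≤ v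
div5-bound m v m≤ = ≤-pred (m<n*o⇒m/o<n {m} {suc v} {5} (≤-trans (s≤s m≤) (≤-reflexive (five v))))
  where
    five : ∀ v → suc (5 * v + 4) ≡ suc v * 5
    five = solve 1 (λ v → con 1 :+ (con 5 :* v :+ con 4) := (con 1 :+ v) :* con 5) refl

-- A maximal run of free cells: whether its left neighbour is a Maker cell, its length, and
-- whether its right neighbour is a Maker cell (the board ends count as non-Maker cells).
-- Runs of length 0 sit between adjacent claimed cells.
data Run : Set where
  run : Bool → ℕ → Bool → Run

-- The runs of a board whose unread part is xs, the part read so far ending in an open run
-- of c free cells whose left neighbour is a Maker cell iff m.
runsFrom : Bool → ℕ → List Cell → List Run
runsFrom m c []             = run m c false ∷ []
runsFrom m c (free ∷ xs)    = runsFrom m (suc c) xs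
runsFrom m c (maker ∷ xs)   = run m c true ∷ runsFrom true 0 xs
runsFrom m c (breaker ∷ xs) = run m c false ∷ runsFrom false 0 xs

runs : List Cell → List Run
runs = runsFrom false 0

closedRuns : Bool → ℕ → List Cell → List Run
closedRuns m c []            = []
closedRuns m c (free ∷ u)    = closedRuns m (suc c) u
closedRuns m c (maker ∷ u)   = run m c true ∷ closedRuns true 0 u
closedRuns m c (breaker ∷ u) = run m c false ∷ closedRuns false 0 u

openBorder : Bool → List Cell → Bool
openBorder m []            = m
openBorder m (free ∷ u)    = openBorder m u
openBorder m (maker ∷ u)   = openBorder true u
openBorder m (breaker ∷ u) = openBorder false u

openLength : ℕ → List Cell → ℕ
openLength c []            = c
openLength c (free ∷ u)    = openLength (suc c) u
openLength c (maker ∷ u)   = openLength 0 u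
openLength c (breaker ∷ u) = openLength 0 u

runsFrom-++ : ∀ m c u w → runsFrom m c (u ++ w) ≡ closedRuns m c u ++ runsFrom (openBorder m u) (openLength c u) w
runsFrom-++ m c []            w = refl
runsFrom-++ m c (free ∷ u)    w = runsFrom-++ m (suc c) u w
runsFrom-++ m c (maker ∷ u)   w = cong (run m c true ∷_) (runsFrom-++ true 0 u w)
runsFrom-++ m c (breaker ∷ u) w = cong (run m c false ∷_) (runsFrom-++ false 0 u w)

leadingFree : List Cell → ℕ
leadingFree (free ∷ v) = suc (leadingFree v)
leadingFree _          = 0

nextIsMaker : List Cell → Bool
nextIsMaker []            = false
nextIsMaker (free ∷ v)    = nextIsMaker v
nextIsMaker (maker ∷ v)   = true
nextIsMaker (breaker ∷ v) = false

laterRuns : List Cell → List Run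
laterRuns []            = []
laterRuns (free ∷ v)    = laterRuns v
laterRuns (maker ∷ v)   = runsFrom true 0 v
laterRuns (breaker ∷ v) = runsFrom false 0 v

runsFrom-lead : ∀ m c v → runsFrom m c v ≡ run m (c + leadingFree v) (nextIsMaker v) ∷ laterRuns v
runsFrom-lead m c []            = cong (λ n → run m n false ∷ []) (sym (+-identityʳ c))
runsFrom-lead m c (free ∷ v)    =
  trans (runsFrom-lead m (suc c) v) (cong (λ n → run m n (nextIsMaker v) ∷ laterRuns v) (sym (+-suc c (leadingFree v))))
runsFrom-lead m c (maker ∷ v)   = cong (λ n → run m n true ∷ runsFrom true 0 v) (sym (+-identityʳ c))
runsFrom-lead m c (breaker ∷ v) = cong (λ n → run m n false ∷ runsFrom false 0 v) (sym (+-identityʳ c))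

runs-around : ∀ u w → runs (u ++ w) ≡ closedRuns false 0 u ++ runsFrom (openBorder false u) (openLength 0 u) w
runs-around = runsFrom-++ false 0

isMaker : Player → Bool
isMaker Maker   = true
isMaker Breaker = false

runs-free : ∀ u v → runs (u ++ free ∷ v) ≡
  closedRuns false 0 u ++ run (openBorder false u) (suc (openLength 0 u + leadingFree v)) (nextIsMaker v) ∷ laterRuns v
runs-free u v = trans (runs-around u (free ∷ v)) (cong (closedRuns false 0 u ++_) (runsFrom-lead _ (suc (openLength 0 u)) v))

runs-claim : ∀ p u v → runs (u ++ owner p ∷ v) ≡
  closedRuns false 0 u ++ run (openBorder false u) (openLength 0 u) (isMaker p)
                       ∷ run (isMaker p) (leadingFree v) (nextIsMaker v) ∷ laterRuns v
runs-claim Maker   u v = trans (runs-around u (maker ∷ v))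
  (cong (λ ρs → closedRuns false 0 u ++ run (openBorder false u) (openLength 0 u) true ∷ ρs) (runsFrom-lead true 0 v))
runs-claim Breaker u v = trans (runs-around u (breaker ∷ v))
  (cong (λ ρs → closedRuns false 0 u ++ run (openBorder false u) (openLength 0 u) false ∷ ρs) (runsFrom-lead false 0 v))

-- Maker pairs in c ∷ xs, where c is the cell preceding xs.
pairsAfter : Cell → List Cell → ℕ
pairsAfter _     []            = 0
pairsAfter maker (maker ∷ xs)  = suc (pairsAfter maker xs)
pairsAfter _     (x ∷ xs)      = pairsAfter x xs

-- The left end of the board acts as a non-Maker cell.
pairs : List Cell → ℕ
pairs = pairsAfter free

score-cons : ∀ {n} x (xs : Vec Cell n) → score (x ∷ᵥ xs) ≡ pairsAfter x (toList xs)
score-cons x       []ᵥ              = refl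
score-cons maker   (maker ∷ᵥ xs)    = cong suc (score-cons maker xs)
score-cons maker   (free ∷ᵥ xs)     = score-cons free xs
score-cons maker   (breaker ∷ᵥ xs)  = score-cons breaker xs
score-cons free    (y ∷ᵥ xs)        = score-cons y xs
score-cons breaker (y ∷ᵥ xs)        = score-cons y xs

score-pairs : ∀ {n} (b : Vec Cell n) → score b ≡ pairs (toList b)
score-pairs []ᵥ       = refl
score-pairs (x ∷ᵥ xs) = score-cons x xs

lastCell : Cell → List Cell → Cell
lastCell c []      = c
lastCell _ (x ∷ u) = lastCell x u

pairsAfter-++ : ∀ c u w → pairsAfter c (u ++ w) ≡ pairsAfter c u + pairsAfter (lastCell c u) w
pairsAfter-++ c       []            w = refl
pairsAfter-++ maker   (maker ∷ u)   w = cong suc (pairsAfter-++ maker u w)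
pairsAfter-++ maker   (free ∷ u)    w = pairsAfter-++ free u w
pairsAfter-++ maker   (breaker ∷ u) w = pairsAfter-++ breaker u w
pairsAfter-++ free    (x ∷ u)       w = pairsAfter-++ x u w
pairsAfter-++ breaker (x ∷ u)       w = pairsAfter-++ x u w

pairs-after-prefix : ∀ u w w' k → (∀ c → k + pairsAfter c w ≤ pairsAfter c w') → k + pairs (u ++ w) ≤ pairs (u ++ w')
pairs-after-prefix u w w' k local
  rewrite pairsAfter-++ free u w | pairsAfter-++ free u w' = begin
    k + (a + pairsAfter c w)   ≡⟨ sym (+-assoc k a _) ⟩
    k + a + pairsAfter c w     ≡⟨ cong (_+ pairsAfter c w) (+-comm k a) ⟩
    a + k + pairsAfter c w     ≡⟨ +-assoc a k _ ⟩
    a + (k + pairsAfter c w)   ≤⟨ +-monoʳ-≤ a (local c) ⟩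
    a + pairsAfter c w'        ∎
  where
    open ≤-Reasoning
    a : ℕ
    a = pairsAfter free u
    c : Cell
    c = lastCell free u

pairsAfter-free≤maker : ∀ v → pairsAfter free v ≤ pairsAfter maker v
pairsAfter-free≤maker []            = z≤n
pairsAfter-free≤maker (maker ∷ v)   = n≤1+n _
pairsAfter-free≤maker (free ∷ v)    = ≤-refl
pairsAfter-free≤maker (breaker ∷ v) = ≤-refl

pairsAfter-breaker : ∀ c v → pairsAfter c (breaker ∷ v) ≡ pairsAfter c (free ∷ v)
pairsAfter-breaker maker   []      = refl
pairsAfter-breaker maker   (_ ∷ _) = refl
pairsAfter-breaker free    []      = refl
pairsAfter-breaker free    (_ ∷ _) = refl
pairsAfter-breaker breaker []      = refl
pairsAfter-breaker breaker (_ ∷ _) = refl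

pairs-claim : ∀ p u v → pairs (u ++ free ∷ v) ≤ pairs (u ++ owner p ∷ v)
pairs-claim p u v = pairs-after-prefix u (free ∷ v) (owner p ∷ v) 0 (local p)
  where
    local : ∀ p c → pairsAfter c (free ∷ v) ≤ pairsAfter c (owner p ∷ v)
    local Maker   maker   = m≤n⇒m≤1+n (pairsAfter-free≤maker v)
    local Maker   free    = pairsAfter-free≤maker v
    local Maker   breaker = pairsAfter-free≤maker v
    local Breaker c       = ≤-reflexive (sym (pairsAfter-breaker c v))

pairs-cash-left : ∀ u v → 1 + pairs (u ++ maker ∷ free ∷ v) ≤ pairs (u ++ maker ∷ maker ∷ v)
pairs-cash-left u v = pairs-after-prefix u (maker ∷ free ∷ v) (maker ∷ maker ∷ v) 1 local
  where
    local : ∀ c → 1 + pairsAfter c (maker ∷ free ∷ v) ≤ pairsAfter c (maker ∷ maker ∷ v)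
    local maker   = s≤s (s≤s (pairsAfter-free≤maker v))
    local free    = s≤s (pairsAfter-free≤maker v)
    local breaker = s≤s (pairsAfter-free≤maker v)

pairs-cash-right : ∀ u v → 1 + pairs (u ++ free ∷ maker ∷ v) ≤ pairs (u ++ maker ∷ maker ∷ v)
pairs-cash-right u v = pairs-after-prefix u (free ∷ maker ∷ v) (maker ∷ maker ∷ v) 1 local
  where
    local : ∀ c → 1 + pairsAfter c (free ∷ maker ∷ v) ≤ pairsAfter c (maker ∷ maker ∷ v)
    local maker   = s≤s (n≤1+n _)
    local free    = ≤-refl
    local breaker = ≤-refl

data RunClass : Set where
  single double long : RunClass

classify : ℕ → RunClass
classify (suc zero)       = single
classify (suc (suc zero)) = double
classify _                = long

hotEntry : ℕ → List RunClass
hotEntry zero    = []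
hotEntry (suc n) = classify (suc n) ∷ []

-- The records of a run in the list of hot runs: none if it is empty or touches no Maker
-- cell, its class if it touches one, and three copies if it touches Maker on both sides,
-- so that such a run alone exceeds the two records allowed in a good position.
hot : Bool → Bool → ℕ → List RunClass
hot false false n = []
hot true  false n = hotEntry n
hot false true  n = hotEntry n
hot true  true  n = hotEntry n ++ hotEntry n ++ hotEntry n

hotRun : Run → List RunClass
hotRun (run a n b) = hot a b n

hotList : List Run → List RunClass
hotList = concatMap hotRun

runExcess : Run → ℕ
runExcess (run _ n _) = excess n

excessSum : List Run → ℕ
excessSum ρs = sum (map runExcess ρs)

GoodRuns : List Run → Set
GoodRuns ρs = length (hotList ρs) ≤ 2

-- Bonus of the hot runs with Maker to move.  Longer lists never occur in good positions.
makerSingle : RunClass → ℕ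
makerSingle single = 5
makerSingle double = 7
makerSingle long   = 6

makerPair : RunClass → RunClass → ℕ
makerPair single single = 7
makerPair single double = 8
makerPair single long   = 7
makerPair double single = 8
makerPair double double = 9
makerPair double long   = 9
makerPair long   single = 7
makerPair long   double = 9
makerPair long   long   = 3

makerBonus : List RunClass → ℕ
makerBonus []          = 3
makerBonus (s ∷ [])    = makerSingle s
makerBonus (s ∷ t ∷ _) = makerPair s t

breakerSingle : RunClass → ℕ
breakerSingle single = 2
breakerSingle double = 3
breakerSingle long   = 2

breakerBonus : List RunClass → ℕ
breakerBonus []          = 0
breakerBonus (s ∷ [])    = breakerSingle s
breakerBonus (s ∷ t ∷ _) = makerPair s t ∸ 3

bonus : Player → List RunClass → ℕ
bonus Maker   = makerBonus
bonus Breaker = breakerBonus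

Ψ : Player → List Run → ℕ
Ψ p ρs = excessSum ρs + bonus p (hotList ρs)

makerPair-sym : ∀ s t → makerPair s t ≡ makerPair t s
makerPair-sym single single = refl
makerPair-sym single double = refl
makerPair-sym single long   = refl
makerPair-sym double single = refl
makerPair-sym double double = refl
makerPair-sym double long   = refl
makerPair-sym long   single = refl
makerPair-sym long   double = refl
makerPair-sym long   long   = refl

breaker+3≤maker : ∀ X → breakerBonus X + 3 ≤ makerBonus X
breaker+3≤maker []                       = byEval
breaker+3≤maker (single ∷ [])            = byEval
breaker+3≤maker (double ∷ [])            = byEval
breaker+3≤maker (long   ∷ [])            = byEval
breaker+3≤maker (s ∷ t ∷ _)              = ≤-reflexive (m∸n+n≡m (three≤ s t))
  where
    three≤ : ∀ s t → 3 ≤ makerPair s t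
    three≤ single single = byEval
    three≤ single double = byEval
    three≤ single long   = byEval
    three≤ double single = byEval
    three≤ double double = byEval
    three≤ double long   = byEval
    three≤ long   single = byEval
    three≤ long   double = byEval
    three≤ long   long   = byEval

makerBonus-swap : ∀ s l → makerBonus (s ∷ hotEntry l) ≡ makerBonus (hotEntry l ++ s ∷ [])
makerBonus-swap s zero    = refl
makerBonus-swap s (suc l) = makerPair-sym s (classify (suc l))

breakerBonus-swap : ∀ s t → breakerBonus (s ∷ t ∷ []) ≡ breakerBonus (t ∷ s ∷ [])
breakerBonus-swap s t = cong (_∸ 3) (makerPair-sym s t)

-- In the following inequalities a claim splits a run of length 1 + l + r into runs of
-- lengths l and r; they are checked on lengths 0‥3 by evaluation and extended by
-- fromThree / shifting.

-- Breaker claims a cell of the only hot run, which touches Maker on its left.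
break-alone : ∀ l r → excess (suc (l + r)) + breakerBonus (classify (suc (l + r)) ∷ [])
                      ≤ (excess l + excess r) + makerBonus (hotEntry l)
break-alone = fromThree _ (shifting λ _ → s≤s) (shifting λ _ → s≤s) (shifting λ _ → s≤s) (shifting λ _ → s≤s)
                        (λ _ below r → s≤s (below r))

-- The same, next to another hot run of class t.
break-beside : ∀ t l r → excess (suc (l + r)) + breakerBonus (classify (suc (l + r)) ∷ t ∷ [])
                         ≤ (excess l + excess r) + makerBonus (hotEntry l ++ t ∷ [])
break-beside single = fromThree _ (shifting λ _ → s≤s) (shifting λ _ → s≤s) (shifting λ _ → s≤s) (shifting λ _ → s≤s)
                                (λ _ below r → s≤s (below r))
break-beside double = fromThree _ (shifting λ _ → s≤s) (shifting λ _ → s≤s) (shifting λ _ → s≤s) (shifting λ _ → s≤s)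
                                (λ _ below r → s≤s (below r))
break-beside long   = fromThree _ (shifting λ _ → s≤s) (shifting λ _ → s≤s) (shifting λ _ → s≤s) (shifting λ _ → s≤s)
                                (λ _ below r → s≤s (below r))

-- Maker claims the end cell of the only hot run next to his own cell: one pair (worth 5)
-- is scored and the rest of the run, of length r, becomes hot.
cash-alone : ∀ r → excess (suc r) + makerBonus (classify (suc r) ∷ []) ≤ 5 + excess r + breakerBonus (hotEntry r)
cash-alone = shifting λ _ → s≤s

-- The same, next to another hot run of class t.
cash-beside : ∀ t r → excess (suc r) + makerBonus (classify (suc r) ∷ t ∷ []) ≤ 5 + excess r + breakerBonus (hotEntry r ++ t ∷ [])
cash-beside single = shifting λ _ → s≤s
cash-beside double = shifting λ _ → s≤s
cash-beside long   = shifting λ _ → s≤s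

-- Maker opens a run of at least 4 free cells (no other hot run) after its second cell.
open-long : ∀ k → excess (4 + k) + makerBonus [] ≤ (excess 2 + excess (suc k)) + breakerBonus (double ∷ classify (suc k) ∷ [])
open-long = shifting λ _ → s≤s

length-middle : ∀ (A B X Y : List RunClass) → length X ≤ length Y → length (A ++ X ++ B) ≤ length (A ++ Y ++ B)
length-middle []      B X Y X≤Y rewrite length-++ X {B} | length-++ Y {B} = +-monoˡ-≤ (length B) X≤Y
length-middle (a ∷ A) B X Y X≤Y = s≤s (length-middle A B X Y X≤Y)

hotEntry-length : ∀ n → length (hotEntry n) ≤ 1
hotEntry-length zero    = z≤n
hotEntry-length (suc n) = s≤s z≤n

not-doubly-hot : ∀ (A B : List RunClass) n → length (A ++ hot true true (suc n) ++ B) ≤ 2 → ⊥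
not-doubly-hot []      B n (s≤s (s≤s ()))
not-doubly-hot (a ∷ A) B n (s≤s h) = not-doubly-hot A B n (m≤n⇒m≤1+n h)

-- Breaker splits a hot run touching Maker on its left, with other hot runs A and B.
break-hot : ∀ A B l r → length (A ++ classify (suc (l + r)) ∷ B) ≤ 2 →
  excess (suc (l + r)) + breakerBonus (A ++ classify (suc (l + r)) ∷ B) ≤ (excess l + excess r) + makerBonus (A ++ hotEntry l ++ B)
break-hot []          []          l r _ rewrite ++-identityʳ (hotEntry l) = break-alone l r
break-hot []          (t ∷ [])    l r _ = break-beside t l r
break-hot (s ∷ [])    []          l r _
  rewrite breakerBonus-swap s (classify (suc (l + r))) | ++-identityʳ (hotEntry l) | makerBonus-swap s l = break-beside s l r
break-hot []          (_ ∷ _ ∷ _) l r (s≤s (s≤s ()))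
break-hot (_ ∷ [])    (_ ∷ _)     l r (s≤s (s≤s ()))
break-hot (_ ∷ _ ∷ [])    B       l r (s≤s (s≤s ()))
break-hot (_ ∷ _ ∷ _ ∷ _) B       l r (s≤s (s≤s ()))

-- The mirror image: the hot run touches Maker on its right.
break-hot-right : ∀ A B l r → length (A ++ classify (suc (l + r)) ∷ B) ≤ 2 →
  excess (suc (l + r)) + breakerBonus (A ++ classify (suc (l + r)) ∷ B) ≤ (excess l + excess r) + makerBonus (A ++ hotEntry r ++ B)
break-hot-right A B l r rewrite +-comm l r | +-comm (excess l) (excess r) = break-hot A B r l

-- Maker claims the end cell of a hot run next to his own cell, with other hot runs A and B.
cash-hot : ∀ A B r → length (A ++ classify (suc r) ∷ B) ≤ 2 →
  excess (suc r) + makerBonus (A ++ classify (suc r) ∷ B) ≤ 5 + excess r + breakerBonus (A ++ hotEntry r ++ B)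
cash-hot []          []          r _ rewrite ++-identityʳ (hotEntry r) = cash-alone r
cash-hot []          (t ∷ [])    r _ = cash-beside t r
cash-hot (s ∷ [])    []          r _
  rewrite ++-identityʳ (hotEntry r) =
    subst₂ (λ x y → excess (suc r) + x ≤ 5 + excess r + y) (makerPair-sym (classify (suc r)) s) (swap r) (cash-beside s r)
  where
    swap : ∀ r → breakerBonus (hotEntry r ++ s ∷ []) ≡ breakerBonus (s ∷ hotEntry r)
    swap zero    = refl
    swap (suc r) = breakerBonus-swap (classify (suc r)) s
cash-hot []          (_ ∷ _ ∷ _) r (s≤s (s≤s ()))
cash-hot (_ ∷ [])    (_ ∷ _)     r (s≤s (s≤s ()))
cash-hot (_ ∷ _ ∷ [])    B       r (s≤s (s≤s ()))
cash-hot (_ ∷ _ ∷ _ ∷ _) B       r (s≤s (s≤s ()))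

-- Replacing run ρ by ρ₁ ρ₂, next to the records A and B of the other hot runs, is
-- admissible from p to move to p' to move with j new pairs when it keeps a good position
-- good and the local potential drops by at most 5j.
record Admissible (p p' : Player) (j : ℕ) (ρ ρ₁ ρ₂ : Run) (A B : List RunClass) : Set where
  constructor admissible
  field
    split : length (A ++ hotRun ρ ++ B) ≤ 2 →
      length (A ++ hotRun ρ₁ ++ hotRun ρ₂ ++ B) ≤ 2 ×
      runExcess ρ + bonus p (A ++ hotRun ρ ++ B) ≤ 5 * j + (runExcess ρ₁ + runExcess ρ₂) + bonus p' (A ++ hotRun ρ₁ ++ hotRun ρ₂ ++ B)

-- Any claim of Breaker.
breaker-split : ∀ A B mL mR l r → Admissible Breaker Maker 0 (run mL (suc (l + r)) mR) (run mL l false) (run false r mR) A B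
breaker-split A B false false l r = admissible λ good → good , quiet
  where
    open ≤-Reasoning
    quiet : excess (suc (l + r)) + breakerBonus (A ++ B) ≤ (excess l + excess r) + makerBonus (A ++ B)
    quiet = begin
      excess (suc (l + r)) + breakerBonus (A ++ B)       ≤⟨ +-monoˡ-≤ _ (excess-split l r) ⟩
      excess l + excess r + 3 + breakerBonus (A ++ B)     ≡⟨ +-assoc (excess l + excess r) 3 _ ⟩
      excess l + excess r + (3 + breakerBonus (A ++ B))   ≡⟨ cong (excess l + excess r +_) (+-comm 3 _) ⟩
      excess l + excess r + (breakerBonus (A ++ B) + 3)   ≤⟨ +-monoʳ-≤ _ (breaker+3≤maker (A ++ B)) ⟩
      excess l + excess r + makerBonus (A ++ B)           ∎
breaker-split A B true  true  l r = admissible λ good → ⊥-elim (not-doubly-hot A B (l + r) good)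
breaker-split A B true  false l r = admissible λ good →
  ≤-trans (length-middle A B (hotEntry l) _ (hotEntry-length l)) good , break-hot A B l r good
breaker-split A B false true  l r = admissible λ good →
  ≤-trans (length-middle A B (hotEntry r) _ (hotEntry-length r)) good , break-hot-right A B l r good

-- Maker claims the free cell just right of one of his cells.
cash-split-left : ∀ A B mR r → Admissible Maker Breaker 1 (run true (suc r) mR) (run true 0 true) (run true r mR) A B
cash-split-left A B true  r = admissible λ good → ⊥-elim (not-doubly-hot A B r good)
cash-split-left A B false r = admissible λ good →
  ≤-trans (length-middle A B (hotEntry r) _ (hotEntry-length r)) good , cash-hot A B r good

-- Maker claims the free cell just left of one of his cells.
cash-split-right : ∀ A B mL l → Admissible Maker Breaker 1 (run mL (suc l) true) (run mL l true) (run true 0 true) A B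
cash-split-right A B true  l = admissible λ good → ⊥-elim (not-doubly-hot A B l good)
cash-split-right A B false l = admissible λ good →
  ≤-trans (length-middle A B (hotEntry l) _ (hotEntry-length l)) good ,
  subst (λ e → excess (suc l) + makerBonus (A ++ classify (suc l) ∷ B) ≤ 5 + e + breakerBonus (A ++ hotEntry l ++ B))
        (sym (+-identityʳ (excess l))) (cash-hot A B l good)

cold-run : ∀ a b n → hot a b (suc n) ≡ [] → a ≡ false × b ≡ false
cold-run false false n _ = refl , refl
cold-run false true  n ()
cold-run true  false n ()
cold-run true  true  n ()

-- With no hot run at all, Maker opens a run of three cells after its first cell and a
-- longer run after its second cell.
open-split : ∀ {mL mR l r A B} → A ≡ [] → B ≡ [] → hot mL mR (suc (l + r)) ≡ [] →
  (l ≡ 1 × r ≡ 1) ⊎ (l ≡ 2 × 1 ≤ r) → Admissible Maker Breaker 0 (run mL (suc (l + r)) mR) (run mL l true) (run true r mR) A B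
open-split {mL} {mR} {l} {r} refl refl cold shape with cold-run mL mR (l + r) cold
open-split refl refl _ (inj₁ (refl , refl))   | refl , refl = admissible λ _ → byEval , byEval
open-split refl refl _ (inj₂ (refl , s≤s _)) | refl , refl = admissible λ _ → s≤s (s≤s z≤n) , open-long _

excessSum-++ : ∀ P Q → excessSum (P ++ Q) ≡ excessSum P + excessSum Q
excessSum-++ P Q = trans (cong sum (map-++ runExcess P Q)) (sum-++ (map runExcess P) (map runExcess Q))

hotList-++ : ∀ P Q → hotList (P ++ Q) ≡ hotList P ++ hotList Q
hotList-++ = concatMap-++ hotRun

rearrange : ∀ a c x y k x₁ x₂ z → x + y ≤ k + (x₁ + x₂) + z → (a + (x + c)) + y ≤ k + ((a + (x₁ + (x₂ + c))) + z)
rearrange a c x y k x₁ x₂ z local = begin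
  (a + (x + c)) + y               ≡⟨ solve 4 (λ a c x y → (a :+ (x :+ c)) :+ y := (a :+ c) :+ (x :+ y)) refl a c x y ⟩
  (a + c) + (x + y)               ≤⟨ +-monoʳ-≤ (a + c) local ⟩
  (a + c) + (k + (x₁ + x₂) + z)   ≡⟨ solve 6 (λ a c k x₁ x₂ z → (a :+ c) :+ (k :+ (x₁ :+ x₂) :+ z) := k :+ ((a :+ (x₁ :+ (x₂ :+ c))) :+ z)) refl a c k x₁ x₂ z ⟩
  k + ((a + (x₁ + (x₂ + c))) + z) ∎
  where open ≤-Reasoning

split-runs : ∀ {p p' j ρ ρ₁ ρ₂} P R → Admissible p p' j ρ ρ₁ ρ₂ (hotList P) (hotList R) →
  GoodRuns (P ++ ρ ∷ R) → GoodRuns (P ++ ρ₁ ∷ ρ₂ ∷ R) × Ψ p (P ++ ρ ∷ R) ≤ 5 * j + Ψ p' (P ++ ρ₁ ∷ ρ₂ ∷ R)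
split-runs {p} {p'} {j} {ρ} {ρ₁} {ρ₂} P R (admissible adm) good
  with adm (subst (λ X → length X ≤ 2) (hotList-++ P (ρ ∷ R)) good)
... | good′ , local = subst (λ X → length X ≤ 2) (sym (hotList-++ P (ρ₁ ∷ ρ₂ ∷ R))) good′ , (begin
  Ψ p (P ++ ρ ∷ R)
    ≡⟨ cong₂ (λ e h → e + bonus p h) (excessSum-++ P (ρ ∷ R)) (hotList-++ P (ρ ∷ R)) ⟩
  (excessSum P + (runExcess ρ + excessSum R)) + bonus p (hotList P ++ hotRun ρ ++ hotList R)
    ≤⟨ rearrange (excessSum P) (excessSum R) (runExcess ρ) _ (5 * j) (runExcess ρ₁) (runExcess ρ₂) _ local ⟩
  5 * j + ((excessSum P + (runExcess ρ₁ + (runExcess ρ₂ + excessSum R))) + bonus p' (hotList P ++ hotRun ρ₁ ++ hotRun ρ₂ ++ hotList R))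
    ≡⟨ cong (5 * j +_) (sym (cong₂ (λ e h → e + bonus p' h) (excessSum-++ P (ρ₁ ∷ ρ₂ ∷ R)) (hotList-++ P (ρ₁ ∷ ρ₂ ∷ R)))) ⟩
  5 * j + Ψ p' (P ++ ρ₁ ∷ ρ₂ ∷ R) ∎)
  where open ≤-Reasoning

Φ : Player → List Cell → ℕ
Φ p xs = 5 * pairs xs + Ψ p (runs xs)

Good : List Cell → Set
Good xs = GoodRuns (runs xs)

Φ-step : ∀ {p p' j} xs ys → j + pairs xs ≤ pairs ys → Ψ p (runs xs) ≤ 5 * j + Ψ p' (runs ys) → Φ p xs ≤ Φ p' ys
Φ-step {p} {p'} {j} xs ys gain local = begin
  5 * pairs xs + Ψ p (runs xs)              ≤⟨ +-monoʳ-≤ (5 * pairs xs) local ⟩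
  5 * pairs xs + (5 * j + Ψ p' (runs ys))   ≡⟨ sym (+-assoc (5 * pairs xs) _ _) ⟩
  5 * pairs xs + 5 * j + Ψ p' (runs ys)     ≡⟨ cong (_+ Ψ p' (runs ys)) (trans (sym (*-distribˡ-+ 5 (pairs xs) j)) (cong (5 *_) (+-comm (pairs xs) j))) ⟩
  5 * (j + pairs xs) + Ψ p' (runs ys)       ≤⟨ +-monoˡ-≤ _ (*-monoʳ-≤ 5 gain) ⟩
  5 * pairs ys + Ψ p' (runs ys)             ∎
  where open ≤-Reasoning

claim-step : ∀ {p p' j ρ ρ₁ ρ₂} xs ys P R → runs xs ≡ P ++ ρ ∷ R → runs ys ≡ P ++ ρ₁ ∷ ρ₂ ∷ R →
  j + pairs xs ≤ pairs ys → Admissible p p' j ρ ρ₁ ρ₂ (hotList P) (hotList R) → Good xs → Good ys × Φ p xs ≤ Φ p' ys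
claim-step {p} {p'} {j} xs ys P R xs≡ ys≡ gain adm good with split-runs P R adm (subst GoodRuns xs≡ good)
... | good′ , local =
  subst GoodRuns (sym ys≡) good′ , Φ-step {p} {p'} {j} xs ys gain (subst₂ (λ a b → Ψ p a ≤ 5 * j + Ψ p' b) (sym xs≡) (sym ys≡) local)

breaker-move : ∀ u v → Good (u ++ free ∷ v) → Good (u ++ breaker ∷ v) × Φ Breaker (u ++ free ∷ v) ≤ Φ Maker (u ++ breaker ∷ v)
breaker-move u v = claim-step (u ++ free ∷ v) (u ++ breaker ∷ v) _ _ (runs-free u v) (runs-claim Breaker u v) (pairs-claim Breaker u v) (breaker-split _ _ _ _ _ _)

record MakerReply (xs : List Cell) : Set where
  constructor reply
  field
    before after : List Cell
    position     : xs ≡ before ++ free ∷ after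
    stays-good   : Good (before ++ maker ∷ after)
    keeps-Φ      : Φ Maker xs ≤ Φ Breaker (before ++ maker ∷ after)

data CashSite (xs : List Cell) : Set where
  after-maker  : ∀ u v → xs ≡ u ++ maker ∷ free ∷ v → CashSite xs
  before-maker : ∀ u v → xs ≡ u ++ free ∷ maker ∷ v → CashSite xs

-- The runs of u ++ maker ∷ w, the run closed by that Maker cell counted with the prefix.
runs-after-maker : ∀ u w → runs (u ++ maker ∷ w) ≡
  (closedRuns false 0 u ++ run (openBorder false u) (openLength 0 u) true ∷ []) ++ runsFrom true 0 w
runs-after-maker u w = trans (runs-around u (maker ∷ w)) (sym (++-assoc (closedRuns false 0 u) _ (runsFrom true 0 w)))

cash-reply : ∀ {xs} → CashSite xs → Good xs → MakerReply xs
cash-reply (before-maker u v refl) good with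
  claim-step (u ++ free ∷ maker ∷ v) (u ++ maker ∷ maker ∷ v) _ _ (runs-around u (free ∷ maker ∷ v)) (runs-around u (maker ∷ maker ∷ v)) (pairs-cash-right u v)
             (cash-split-right _ _ _ _) good
... | good′ , keeps = reply u (maker ∷ v) refl good′ keeps
cash-reply (after-maker u v refl) good with
  claim-step (u ++ maker ∷ free ∷ v) (u ++ maker ∷ maker ∷ v) _ _ (trans (runs-after-maker u (free ∷ v)) (cong (_ ++_) (runsFrom-lead true 1 v)))
             (trans (runs-after-maker u (maker ∷ v)) (cong (λ ρs → _ ++ run true 0 true ∷ ρs) (runsFrom-lead true 0 v)))
             (pairs-cash-left u v)
             (cash-split-left _ _ _ _) good
... | good′ , keeps = reply (u ++ maker ∷ []) v (sym (shift (free ∷ v)))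
  (subst Good (sym (shift (maker ∷ v))) good′) (subst (λ ys → Φ Maker (u ++ maker ∷ free ∷ v) ≤ Φ Breaker ys) (sym (shift (maker ∷ v))) keeps)
  where
    shift : ∀ w → (u ++ maker ∷ []) ++ w ≡ u ++ maker ∷ w
    shift = ++-assoc u (maker ∷ [])

-- The first or second cell of a run of at least three free cells, the run being of length
-- three in the first case.
record FreshSite (xs : List Cell) : Set where
  constructor fresh
  field
    before after : List Cell
    position     : xs ≡ before ++ free ∷ after
    shape        : (openLength 0 before ≡ 1 × leadingFree after ≡ 1) ⊎ (openLength 0 before ≡ 2 × 1 ≤ leadingFree after)

fresh-reply : ∀ {xs} → hotList (runs xs) ≡ [] → FreshSite xs → MakerReply xs
fresh-reply {xs} cold (fresh u v refl shape) =
  reply u v refl (proj₁ outcome) (proj₂ outcome)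
  where
    P : List Run
    P = closedRuns false 0 u
    ρ : Run
    ρ = run (openBorder false u) (suc (openLength 0 u + leadingFree v)) (nextIsMaker v)
    cold′ : hotList P ++ hotRun ρ ++ hotList (laterRuns v) ≡ []
    cold′ = trans (sym (hotList-++ P (ρ ∷ laterRuns v))) (trans (cong hotList (sym (runs-free u v))) cold)
    rest-cold : hotRun ρ ++ hotList (laterRuns v) ≡ []
    rest-cold = ++-conicalʳ (hotList P) _ cold′
    outcome : Good (u ++ maker ∷ v) × Φ Maker xs ≤ Φ Breaker (u ++ maker ∷ v)
    outcome = claim-step (u ++ free ∷ v) (u ++ maker ∷ v) P (laterRuns v) (runs-free u v) (runs-claim Maker u v)
      (pairs-claim Maker u v)
      (open-split (++-conicalˡ (hotList P) _ cold′) (++-conicalʳ (hotRun ρ) _ rest-cold)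
                  (++-conicalˡ (hotRun ρ) _ rest-cold) shape)
      (subst (λ X → length X ≤ 2) (sym cold) z≤n)

-- The open run (c cells, left neighbour Maker iff m) has no Maker neighbour so far, and the
-- next cell gives it none.
Quiet : Bool → ℕ → List Cell → Set
Quiet true  (suc _) _           = ⊥
Quiet true  zero    (free ∷ _)  = ⊥
Quiet _     (suc _) (maker ∷ _) = ⊥
Quiet _     _       _           = ⊤

cons-cash : ∀ x {xs} → CashSite xs → CashSite (x ∷ xs)
cons-cash x (after-maker u v e)  = after-maker (x ∷ u) v (cong (x ∷_) e)
cons-cash x (before-maker u v e) = before-maker (x ∷ u) v (cong (x ∷_) e)

cold-empty : ∀ a b {H : List RunClass} → H ≡ [] → hot a b 0 ++ H ≡ []
cold-empty false false e = e
cold-empty false true  e = e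
cold-empty true  false e = e
cold-empty true  true  e = e

find-cash : ∀ m c xs → Quiet m c xs → CashSite xs ⊎ hotList (runsFrom m c xs) ≡ []
find-cash false c       []                     _  = inj₂ refl
find-cash true  zero    []                     _  = inj₂ refl
find-cash m     c       (maker ∷ free ∷ xs)    _  = inj₁ (after-maker [] xs refl)
find-cash m     c       (free ∷ maker ∷ xs)    _  = inj₁ (before-maker [] xs refl)
find-cash true  (suc _) _                      ()
find-cash true  zero    (free ∷ _)             ()
find-cash false (suc _) (maker ∷ _)            ()
find-cash false c       (free ∷ [])            _  = Sum.map₁ (cons-cash free) (find-cash false (suc c) [] tt)
find-cash false c       (free ∷ free ∷ xs)     _  = Sum.map₁ (cons-cash free) (find-cash false (suc c) (free ∷ xs) tt)
find-cash false c       (free ∷ breaker ∷ xs)  _  = Sum.map₁ (cons-cash free) (find-cash false (suc c) (breaker ∷ xs) tt)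
find-cash m     zero    (maker ∷ [])           _  = Sum.map (cons-cash maker) (cold-empty m true) (find-cash true 0 [] tt)
find-cash m     zero    (maker ∷ maker ∷ xs)   _  =
  Sum.map (cons-cash maker) (cold-empty m true) (find-cash true 0 (maker ∷ xs) tt)
find-cash m     zero    (maker ∷ breaker ∷ xs) _  =
  Sum.map (cons-cash maker) (cold-empty m true) (find-cash true 0 (breaker ∷ xs) tt)
find-cash false c       (breaker ∷ xs)         _  = Sum.map₁ (cons-cash breaker) (find-cash false 0 xs tt)
find-cash true  zero    (breaker ∷ xs)         _  = Sum.map₁ (cons-cash breaker) (find-cash false 0 xs tt)

cons-fresh : ∀ p {xs} → (∀ u → openLength 0 (p ++ u) ≡ openLength 0 u) → FreshSite xs → FreshSite (p ++ xs)
cons-fresh p resets (fresh u w refl shape) =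
  fresh (p ++ u) w (sym (++-assoc p u (free ∷ w)))
        (subst (λ n → (n ≡ 1 × leadingFree w ≡ 1) ⊎ (n ≡ 2 × 1 ≤ leadingFree w)) (sym (resets u)) shape)

find-fresh : ∀ m xs → FreshSite xs ⊎ excessSum (runsFrom m 0 xs) ≡ 0
find-fresh m []                                 = inj₂ refl
find-fresh m (free ∷ [])                        = inj₂ refl
find-fresh m (free ∷ free ∷ [])                 = inj₂ refl
find-fresh m (free ∷ free ∷ free ∷ [])          = inj₁ (fresh (free ∷ []) (free ∷ []) refl (inj₁ (refl , refl)))
find-fresh m (free ∷ free ∷ free ∷ free ∷ w)    = inj₁ (fresh (free ∷ free ∷ []) (free ∷ w) refl (inj₂ (refl , s≤s z≤n)))
find-fresh m (free ∷ free ∷ free ∷ maker ∷ w)   = inj₁ (fresh (free ∷ []) (free ∷ maker ∷ w) refl (inj₁ (refl , refl)))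
find-fresh m (free ∷ free ∷ free ∷ breaker ∷ w) = inj₁ (fresh (free ∷ []) (free ∷ breaker ∷ w) refl (inj₁ (refl , refl)))
find-fresh m (free ∷ free ∷ maker ∷ w)          = Sum.map₁ (cons-fresh (free ∷ free ∷ maker ∷ []) λ _ → refl) (find-fresh true w)
find-fresh m (free ∷ free ∷ breaker ∷ w)        = Sum.map₁ (cons-fresh (free ∷ free ∷ breaker ∷ []) λ _ → refl) (find-fresh false w)
find-fresh m (free ∷ maker ∷ w)                 = Sum.map₁ (cons-fresh (free ∷ maker ∷ []) λ _ → refl) (find-fresh true w)
find-fresh m (free ∷ breaker ∷ w)               = Sum.map₁ (cons-fresh (free ∷ breaker ∷ []) λ _ → refl) (find-fresh false w)
find-fresh m (maker ∷ w)                        = Sum.map₁ (cons-fresh (maker ∷ []) λ _ → refl) (find-fresh true w)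
find-fresh m (breaker ∷ w)                      = Sum.map₁ (cons-fresh (breaker ∷ []) λ _ → refl) (find-fresh false w)

Settled : List Cell → Set
Settled xs = hotList (runs xs) ≡ [] × excessSum (runs xs) ≡ 0

maker-options : ∀ xs → Good xs → MakerReply xs ⊎ Settled xs
maker-options xs good with find-cash false 0 xs tt
... | inj₁ site = inj₁ (cash-reply site good)
... | inj₂ cold with find-fresh false xs
...   | inj₁ site = inj₁ (fresh-reply cold site)
...   | inj₂ flat = inj₂ (cold , flat)

freeCells : List Cell → ℕ
freeCells []          = 0
freeCells (free ∷ xs) = suc (freeCells xs)
freeCells (_ ∷ xs)    = freeCells xs

full-settled : ∀ m xs → freeCells xs ≡ 0 → hotList (runsFrom m 0 xs) ≡ [] × excessSum (runsFrom m 0 xs) ≡ 0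
full-settled m []             _ = cold-empty m false refl , refl
full-settled m (maker ∷ xs)   e with full-settled true xs e
... | cold , flat = cold-empty m true cold , flat
full-settled m (breaker ∷ xs) e with full-settled false xs e
... | cold , flat = cold-empty m false cold , flat

settled-bound : ∀ p xs → Settled xs → Φ p xs ≤ 5 * pairs xs + 3
settled-bound p xs (cold , flat) = begin
  5 * pairs xs + (excessSum (runs xs) + bonus p (hotList (runs xs)))  ≡⟨ cong₂ (λ e h → 5 * pairs xs + (e + bonus p h)) flat cold ⟩
  5 * pairs xs + bonus p []                                           ≤⟨ +-monoʳ-≤ (5 * pairs xs) (empty-bonus p) ⟩
  5 * pairs xs + 3                                                    ∎
  where
    open ≤-Reasoning
    empty-bonus : ∀ p → bonus p [] ≤ 3
    empty-bonus Maker   = ≤-refl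
    empty-bonus Breaker = z≤n

Claim : Player → ∀ {n} → Vec Cell n → Vec Cell n → Set
Claim p b c = ∃₂ λ u v → toList b ≡ u ++ free ∷ v × toList c ≡ u ++ owner p ∷ v

moves-behind : ∀ {p n} x {xs : Vec Cell n} → (∀ c → c ∈ moves p xs → Claim p xs c) →
               ∀ c → c ∈ map (x ∷ᵥ_) (moves p xs) → Claim p (x ∷ᵥ xs) c
moves-behind x claim c c∈ with ∈-map⁻ (x ∷ᵥ_) c∈
... | c′ , c′∈ , refl with claim c′ c′∈
...   | u , v , xs≡ , c′≡ = x ∷ u , v , cong (x ∷_) xs≡ , cong (x ∷_) c′≡

moves-claim : ∀ p {n} (b : Vec Cell n) c → c ∈ moves p b → Claim p b c
moves-claim p (free ∷ᵥ xs)    c (here refl) = [] , toList xs , refl , refl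
moves-claim p (free ∷ᵥ xs)    c (there c∈)  = moves-behind free (moves-claim p xs) c c∈
moves-claim p (maker ∷ᵥ xs)   c c∈          = moves-behind maker (moves-claim p xs) c c∈
moves-claim p (breaker ∷ᵥ xs) c c∈          = moves-behind breaker (moves-claim p xs) c c∈

claim-move : ∀ p {n} (b : Vec Cell n) u v → toList b ≡ u ++ free ∷ v → ∃ λ c → c ∈ moves p b × toList c ≡ u ++ owner p ∷ v
claim-move p (x ∷ᵥ xs) []      v refl = owner p ∷ᵥ xs , here refl , refl
claim-move p (x ∷ᵥ xs) (y ∷ u) v e with ∷-injective e
... | refl , xs≡ with claim-move p xs u v xs≡
...   | c , c∈ , c≡ = x ∷ᵥ c , behind x , cong (x ∷_) c≡
  where
    behind : ∀ x → (x ∷ᵥ c) ∈ moves p (x ∷ᵥ xs)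
    behind free    = there (∈-map⁺ (free ∷ᵥ_) c∈)
    behind maker   = ∈-map⁺ (maker ∷ᵥ_) c∈
    behind breaker = ∈-map⁺ (breaker ∷ᵥ_) c∈

map-empty : ∀ {A B : Set} {f : A → B} {xs} → map f xs ≡ [] → xs ≡ []
map-empty {xs = []} _ = refl

moves-none : ∀ p {n} (b : Vec Cell n) → moves p b ≡ [] → freeCells (toList b) ≡ 0
moves-none p []ᵥ             _    = refl
moves-none p (maker ∷ᵥ xs)   none = moves-none p xs (map-empty none)
moves-none p (breaker ∷ᵥ xs) none = moves-none p xs (map-empty none)

freeCells-bound : ∀ {n} (b : Vec Cell n) → freeCells (toList b) ≤ n
freeCells-bound []ᵥ             = z≤n
freeCells-bound (free ∷ᵥ xs)    = s≤s (freeCells-bound xs)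
freeCells-bound (maker ∷ᵥ xs)   = m≤n⇒m≤1+n (freeCells-bound xs)
freeCells-bound (breaker ∷ᵥ xs) = m≤n⇒m≤1+n (freeCells-bound xs)

freeCells-claim : ∀ p u v → freeCells (u ++ free ∷ v) ≡ suc (freeCells (u ++ owner p ∷ v))
freeCells-claim Maker   []            v = refl
freeCells-claim Breaker []            v = refl
freeCells-claim p       (free ∷ u)    v = cong suc (freeCells-claim p u v)
freeCells-claim p       (maker ∷ u)   v = freeCells-claim p u v
freeCells-claim p       (breaker ∷ u) v = freeCells-claim p u v

fuel-after : ∀ p f {n} {b c : Vec Cell n} → Claim p b c → freeCells (toList b) ≤ suc f → freeCells (toList c) ≤ f
fuel-after p f (u , v , b≡ , c≡) fuel =
  subst (λ xs → freeCells xs ≤ f) (sym c≡) (≤-pred (subst (_≤ suc f) (trans (cong freeCells b≡) (freeCells-claim p u v)) fuel))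

score-move : ∀ p {n} (b c : Vec Cell n) → c ∈ moves p b → score b ≤ score c
score-move p b c c∈ with moves-claim p b c c∈
... | u , v , b≡ , c≡ rewrite score-pairs b | score-pairs c | b≡ | c≡ = pairs-claim p u v

maxL-upper : ∀ x xs {y} → y ∈ x ∷ xs → y ≤ maxL x xs
maxL-upper x []       (here refl)         = ≤-refl
maxL-upper x (z ∷ zs) (here refl)         = ≤-trans (maxL-upper x zs (here refl)) (m≤n⊔m z _)
maxL-upper x (z ∷ zs) (there (here refl)) = m≤m⊔n z _
maxL-upper x (z ∷ zs) (there (there y∈))  = ≤-trans (maxL-upper x zs (there y∈)) (m≤n⊔m z _)

minL-preserves : ∀ (P : ℕ → Set) {x xs} → P x → All P xs → P (minL x xs)
minL-preserves P = foldr-preservesᵇ {P = P} keep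
  where
    keep : ∀ {y z} → P y → P z → P (y ⊓ z)
    keep {y} {z} py pz with ⊓-sel y z
    ... | inj₁ y⊓z≡y = subst P (sym y⊓z≡y) py
    ... | inj₂ y⊓z≡z = subst P (sym y⊓z≡z) pz

value-Maker : ∀ f {n} (b : Vec Cell n) c → c ∈ moves Maker b → value f Breaker c ≤ value (suc f) Maker b
value-Maker f b c c∈ with moves Maker b | c∈
... | c₀ ∷ cs | c∈′ = maxL-upper _ _ (∈-map⁺ (value f Breaker) c∈′)

value-Breaker : ∀ f {n} (b : Vec Cell n) (P : ℕ → Set) → (moves Breaker b ≡ [] → P (score b)) →
                (∀ c → c ∈ moves Breaker b → P (value f Maker c)) → P (value (suc f) Breaker b)
value-Breaker f b P none each with moves Breaker b
... | []     = none refl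
... | c₀ ∷ cs = minL-preserves P (each c₀ (here refl)) (map⁺ (tabulate λ c∈ → each _ (there c∈)))

score≤value : ∀ f p {n} (b : Vec Cell n) → score b ≤ value f p b
score≤value zero    p       b = ≤-refl
score≤value (suc f) Maker   b with moves Maker b in moves≡
... | []     = ≤-refl
... | c ∷ cs = ≤-trans (score-move Maker b c (subst (c ∈_) (sym moves≡) (here refl)))
                       (≤-trans (score≤value f Breaker c) (maxL-upper (value f Breaker c) (map (value f Breaker) cs) (here refl)))
score≤value (suc f) Breaker b =
  value-Breaker f b (score b ≤_) (λ _ → ≤-refl) (λ c c∈ → ≤-trans (score-move Breaker b c c∈) (score≤value f Maker c))

mutual
  maker-bound : ∀ f {n} (b : Vec Cell n) → Good (toList b) → freeCells (toList b) ≤ f → Φ Maker (toList b) ≤ 5 * value f Maker b + 3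
  maker-bound zero    b good fuel =
    subst (λ s → Φ Maker (toList b) ≤ 5 * s + 3) (sym (score-pairs b)) (settled-bound Maker (toList b) (full-settled false (toList b) (n≤0⇒n≡0 fuel)))
  maker-bound (suc f) b good fuel with maker-options (toList b) good
  ... | inj₁ move    = maker-plays f b move fuel
  ... | inj₂ settled = begin
    Φ Maker (toList b)              ≤⟨ settled-bound Maker (toList b) settled ⟩
    5 * pairs (toList b) + 3        ≡⟨ cong (λ s → 5 * s + 3) (sym (score-pairs b)) ⟩
    5 * score b + 3                 ≤⟨ +-monoˡ-≤ 3 (*-monoʳ-≤ 5 (score≤value (suc f) Maker b)) ⟩
    5 * value (suc f) Maker b + 3   ∎
    where open ≤-Reasoning

  maker-plays : ∀ f {n} (b : Vec Cell n) → MakerReply (toList b) → freeCells (toList b) ≤ suc f →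
                Φ Maker (toList b) ≤ 5 * value (suc f) Maker b + 3
  maker-plays f b (reply u v b≡ good keeps) fuel with claim-move Maker b u v b≡
  ... | c , c∈ , c≡ = begin
    Φ Maker (toList b)              ≤⟨ keeps ⟩
    Φ Breaker (u ++ maker ∷ v)      ≡⟨ cong (Φ Breaker) (sym c≡) ⟩
    Φ Breaker (toList c)            ≤⟨ breaker-bound f c (subst Good (sym c≡) good) (fuel-after Maker f (u , v , b≡ , c≡) fuel) ⟩
    5 * value f Breaker c + 3       ≤⟨ +-monoˡ-≤ 3 (*-monoʳ-≤ 5 (value-Maker f b c c∈)) ⟩
    5 * value (suc f) Maker b + 3   ∎
    where open ≤-Reasoning

  breaker-bound : ∀ f {n} (b : Vec Cell n) → Good (toList b) → freeCells (toList b) ≤ f → Φ Breaker (toList b) ≤ 5 * value f Breaker b + 3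
  breaker-bound zero    b good fuel =
    subst (λ s → Φ Breaker (toList b) ≤ 5 * s + 3) (sym (score-pairs b)) (settled-bound Breaker (toList b) (full-settled false (toList b) (n≤0⇒n≡0 fuel)))
  breaker-bound (suc f) b good fuel = value-Breaker f b (λ z → Φ Breaker (toList b) ≤ 5 * z + 3) stuck answer
    where
      stuck : moves Breaker b ≡ [] → Φ Breaker (toList b) ≤ 5 * score b + 3
      stuck none = subst (λ s → Φ Breaker (toList b) ≤ 5 * s + 3) (sym (score-pairs b))
                         (settled-bound Breaker (toList b) (full-settled false (toList b) (moves-none Breaker b none)))
      answer : ∀ c → c ∈ moves Breaker b → Φ Breaker (toList b) ≤ 5 * value f Maker c + 3
      answer c c∈ with moves-claim Breaker b c c∈
      ... | u , v , b≡ , c≡ with breaker-move u v (subst Good b≡ good)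
      ...   | good′ , keeps = begin
        Φ Breaker (toList b)        ≡⟨ cong (Φ Breaker) b≡ ⟩
        Φ Breaker (u ++ free ∷ v)   ≤⟨ keeps ⟩
        Φ Maker (u ++ breaker ∷ v)  ≡⟨ cong (Φ Maker) (sym c≡) ⟩
        Φ Maker (toList c)          ≤⟨ maker-bound f c (subst Good (sym c≡) good′) (fuel-after Breaker f (u , v , b≡ , c≡) fuel) ⟩
        5 * value f Maker c + 3     ∎
        where open ≤-Reasoning

breakers : List Cell → ℕ
breakers []             = 0
breakers (breaker ∷ xs) = suc (breakers xs)
breakers (_ ∷ xs)       = breakers xs

initial-shape : ∀ n k (b : Vec Cell n) → b ∈ initial n k → All (_≢ maker) (toList b) × breakers (toList b) ≡ k
initial-shape zero    zero    []ᵥ (here refl) = [] , refl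
initial-shape (suc n) zero    b   b∈ with ∈-map⁻ (free ∷ᵥ_) b∈
... | b′ , b′∈ , refl with initial-shape n zero b′ b′∈
...   | none , count = (λ ()) ∷ none , count
initial-shape (suc n) (suc k) b   b∈ with ∈-++⁻ (map (breaker ∷ᵥ_) (initial n k)) b∈
... | inj₁ b∈₁ with ∈-map⁻ (breaker ∷ᵥ_) b∈₁
...   | b′ , b′∈ , refl with initial-shape n k b′ b′∈
...     | none , count = (λ ()) ∷ none , cong suc count
initial-shape (suc n) (suc k) b   b∈ | inj₂ b∈₂ with ∈-map⁻ (free ∷ᵥ_) b∈₂
...   | b′ , b′∈ , refl with initial-shape n (suc k) b′ b′∈
...     | none , count = (λ ()) ∷ none , count

some-initial : ∀ {n k} → k ≤ n → ∃ λ (b : Vec Cell n) → b ∈ initial n k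
some-initial {zero}  {zero}  z≤n = []ᵥ , here refl
some-initial {suc n} {zero}  z≤n with some-initial {n} {zero} z≤n
... | b , b∈ = free ∷ᵥ b , ∈-map⁺ (free ∷ᵥ_) b∈
some-initial {suc n} {suc k} (s≤s k≤n) with some-initial k≤n
... | b , b∈ = breaker ∷ᵥ b , ∈-++⁺ˡ (∈-map⁺ (breaker ∷ᵥ_) b∈)

-- Without Maker cells no run is hot ...
no-maker-cold : ∀ c xs → All (_≢ maker) xs → hotList (runsFrom false c xs) ≡ []
no-maker-cold c []             []         = refl
no-maker-cold c (free ∷ xs)    (_ ∷ rest) = no-maker-cold (suc c) xs rest
no-maker-cold c (maker ∷ xs)   (not ∷ _)  = ⊥-elim (not refl)
no-maker-cold c (breaker ∷ xs) (_ ∷ rest) = no-maker-cold 0 xs rest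

-- ... and the free cells form at most one run more than there are Breaker cells, each run
-- losing at most two cells to its excess.
no-maker-excess : ∀ c xs → All (_≢ maker) xs → c + length xs + 2 ≤ excessSum (runsFrom false c xs) + 3 * breakers xs + 4
no-maker-excess c []             []         = begin
  c + 0 + 2                         ≤⟨ +-monoˡ-≤ 2 (+-monoˡ-≤ 0 (m≤n+m∸n c 2)) ⟩
  2 + excess c + 0 + 2              ≡⟨ solve 1 (λ e → con 2 :+ e :+ con 0 :+ con 2 := e :+ con 0 :+ con 3 :* con 0 :+ con 4) refl (excess c) ⟩
  excess c + 0 + 3 * 0 + 4          ∎
  where open ≤-Reasoning
no-maker-excess c (free ∷ xs)    (_ ∷ rest) =
  subst (_≤ excessSum (runsFrom false (suc c) xs) + 3 * breakers xs + 4) (cong (_+ 2) (sym (+-suc c (length xs))))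
        (no-maker-excess (suc c) xs rest)
no-maker-excess c (maker ∷ xs)   (not ∷ _)  = ⊥-elim (not refl)
no-maker-excess c (breaker ∷ xs) (_ ∷ rest) = begin
  c + suc (length xs) + 2                                  ≡⟨ solve 2 (λ c l → c :+ (con 1 :+ l) :+ con 2 := (c :+ con 1) :+ (con 0 :+ l :+ con 2)) refl c (length xs) ⟩
  (c + 1) + (0 + length xs + 2)                            ≤⟨ +-mono-≤ (+-monoˡ-≤ 1 (m≤n+m∸n c 2)) (no-maker-excess 0 xs rest) ⟩
  (2 + excess c + 1) + (E + 3 * breakers xs + 4)           ≡⟨ solve 3 (λ e E b → (con 2 :+ e :+ con 1) :+ (E :+ con 3 :* b :+ con 4) := e :+ E :+ con 3 :* (con 1 :+ b) :+ con 4) refl (excess c) E (breakers xs) ⟩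
  excess c + E + 3 * suc (breakers xs) + 4                 ∎
  where
    open ≤-Reasoning
    E : ℕ
    E = excessSum (runsFrom false 0 xs)

initial-bound : ∀ n k (b : Vec Cell n) → b ∈ initial n k → (n + 2 ∸ 3 * k) / 5 ≤ value n Maker b
initial-bound n k b b∈ with initial-shape n k b b∈
... | none , count = div5-bound _ _ (begin
  n + 2 ∸ 3 * k              ≤⟨ m≤n+o⇒m∸n≤o (n + 2) (3 * k) room ⟩
  E + 4                      ≤⟨ +-monoˡ-≤ 4 E≤ ⟩
  5 * value n Maker b + 4    ∎)
  where
    open ≤-Reasoning
    E : ℕ
    E = excessSum (runs (toList b))
    cold : hotList (runs (toList b)) ≡ []
    cold = no-maker-cold 0 (toList b) none
    E≤ : E ≤ 5 * value n Maker b
    E≤ = +-cancelʳ-≤ 3 _ _ (begin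
      E + 3                                    ≤⟨ m≤n+m (E + 3) (5 * pairs (toList b)) ⟩
      5 * pairs (toList b) + (E + makerBonus [])  ≡⟨ cong (λ h → 5 * pairs (toList b) + (E + makerBonus h)) (sym cold) ⟩
      Φ Maker (toList b)                       ≤⟨ maker-bound n b (subst (λ X → length X ≤ 2) (sym cold) z≤n) (freeCells-bound b) ⟩
      5 * value n Maker b + 3                  ∎)
    room : n + 2 ≤ 3 * k + (E + 4)
    room = begin
      n + 2                                        ≡⟨ cong (_+ 2) (sym (length-toList b)) ⟩
      0 + length (toList b) + 2                    ≤⟨ no-maker-excess 0 (toList b) none ⟩
      E + 3 * breakers (toList b) + 4              ≡⟨ cong (λ m → E + 3 * m + 4) count ⟩
      E + 3 * k + 4                                ≡⟨ solve 2 (λ E k → E :+ con 3 :* k :+ con 4 := con 3 :* k :+ (E :+ con 4)) refl E k ⟩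
      3 * k + (E + 4)                              ∎

lemma3 : (n k : ℕ) → k ≤ n → (n + 2 ∸ 3 * k) / 5 ≤ α n k
lemma3 n k k≤n with initial n k in choices
... | [] with some-initial k≤n
...   | b , b∈ = ⊥-elim (¬Any[] (subst (b ∈_) choices b∈))
lemma3 n k k≤n | b ∷ bs =
  minL-preserves (λ v → (n + 2 ∸ 3 * k) / 5 ≤ v) (initial-bound n k b (chosen (here refl)))
                 (map⁺ (tabulate λ b′∈ → initial-bound n k _ (chosen (there b′∈))))
  where
    chosen : ∀ {c} → c ∈ b ∷ bs → c ∈ initial n k
    chosen = subst (_ ∈_) (sym choices)
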